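{- Let $\epsilon \in (0,0.1)$. Consider an instance $A=(U,V,w)$ of the online matching problem (defined in the context) with nonnegative weight function $w$. Suppose that when each online point $v\in V$ arrives, the algorithm does not know the true weights $w(u,v)$ but only approximate weights $\tilde w(u,v)$ for all $u\in U$ satisfying $$(1-\epsilon)\,w(u,v)\le \tilde w(u,v)\le (1+\epsilon)\,w(u,v).$$ Then there exists a greedy online matching algorithm with competitive ratio $\frac12(1-2\epsilon)$, i.e. its matching value $\mathsf{alg}$ satisfies $\mathsf{alg}\ge \frac12(1-2\epsilon)\,\mathsf{opt}$, where $\mathsf{opt}$ is the maximum matching value achievable on the instance.
   Context: Online matching problem: a finite set $U$ of offline points is known in advance; online points $v\in V$ arrive one at a time, and upon arrival each $v$ must be irrevocably matched to some $u\in U$ without knowledge of future online points. An offline point may be matched to several online points; the value of a matching is $\sum_{u\in U}\max\{w(u,v): v\in V \text{ matched to } u\}$ (a term is $0$ if $u$ has no partner), where $w\ge 0$ is the weight function. $\mathsf{opt}$ denotes the maximum value over all assignments of the online points to offline points. An online algorithm is $\Gamma$-competitive if its value is always at least $\Gamma\cdot\mathsf{opt}$. The greedy algorithm maintains for each $u$ the current value $w_u$ (max weight of an online point matched to $u$, initially $0$) and matches each arriving $v$ to a $u$ maximizing the increment $\max\{w(u,v)-w_u,0\}$ (here computed with the available weights).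
   Formalization: The parameter ε, the true weights $w(u,v)$ and the approximate weights $\tilde w(u,v)$ are rational numbers rather than real numbers. -}

module Defs where

open import Data.Nat using (ℕ)
open import Data.Fin using (Fin; _<_)
open import Data.Fin.Properties using (_≟_; _<?_)
open import Data.List using (List; []; _∷_; filter; foldr; map)
open import Data.List using (allFin)
open import Data.Rational using (ℚ; 0ℚ; _⊔_; _+_; _-_; _≤_)
open import Relation.Nullary using (yes; no)

-- Offline points: Fin m.  Online points: Fin n, arriving in the order
-- 0, 1, ..., n-1.  A weight function is  Fin m → Fin n → ℚ.
-- An assignment (matching of online points) is  Fin n → Fin m.

Weights : ℕ → ℕ → Set
Weights m n = Fin m → Fin n → ℚ

Assignment : ℕ → ℕ → Set
Assignment m n = Fin n → Fin m

sumFin : ∀ {m} → (Fin m → ℚ) → ℚ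
sumFin {m} f = foldr _+_ 0ℚ (map f (allFin m))

-- maximum weight w u j over the online points j in js assigned to u
-- (0 if there is none; weights are nonnegative so this is the value of u)
maxMatched : ∀ {m n} → Assignment m n → Weights m n → Fin m → List (Fin n) → ℚ
maxMatched a w u [] = 0ℚ
maxMatched a w u (j ∷ js) with a j ≟ u
... | yes _ = w u j ⊔ maxMatched a w u js
... | no  _ = maxMatched a w u js

value : ∀ {m n} → Weights m n → Assignment m n → ℚ
value {m} {n} w a = sumFin (λ u → maxMatched a w u (allFin n))

before : ∀ {n} → Fin n → List (Fin n)
before {n} j = filter (λ i → i <? j) (allFin n)

currentValue : ∀ {m n} → Weights m n → Assignment m n → Fin n → Fin m → ℚ
currentValue w̃ a j u = maxMatched a w̃ u (before j)

increment : ∀ {m n} → Weights m n → Assignment m n → Fin n → Fin m → ℚ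
increment w̃ a j u = (w̃ u j - currentValue w̃ a j u) ⊔ 0ℚ

-- The condition at j only involves w̃ on
-- points arrived so far and a on earlier points, so this is online.
IsGreedyRun : ∀ {m n} → Weights m n → Assignment m n → Set
IsGreedyRun w̃ a = ∀ j u → increment w̃ a j u ≤ increment w̃ a j (a j)

Nonneg : ∀ {m n} → Weights m n → Set
Nonneg w = ∀ u j → 0ℚ ≤ w u j

{-# OPTIONS --safe #-}

-- Let A_u and B_u be the values held at u by the greedy run a and by any assignment b,
-- both measured with the available weights w̃. The potential Σ_u max(A_u, B_u) starts at 0,
-- dominates the value of b, and grows on each arrival by at most twice the gain of greedy,
-- so greedy is ½-competitive for w̃. Comparing weights then gives
-- (1 - ε) val_w(b) ≤ val_w̃(b) ≤ 2 val_w̃(a) ≤ 2 (1 + ε) val_w(a),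
-- and (1 - ε) / (2 (1 + ε)) ≥ ½ (1 - 2ε).
module Submission where

open import Defs
open import Data.Nat using (ℕ)
open import Data.Integer using (+_)
open import Data.Rational using (ℚ; 0ℚ; 1ℚ; ½; _/_; _+_; _-_; _*_; _≤_; _<_)

open import Algebra.Bundles using (CommutativeRing)
import Data.Nat as ℕ
import Data.Nat.Properties as ℕ
open import Data.Fin using (Fin; zero; suc; toℕ; fromℕ<)
open import Data.Fin.Properties using (_≟_; _<?_; toℕ-fromℕ<; toℕ-injective; toℕ<n)
open import Data.List using (List; []; _∷_; foldr; allFin; tabulate)
open import Data.List.Properties using (map-tabulate)
open import Data.List.Membership.Propositional using (_∈_)
open import Data.List.Membership.Propositional.Properties using (∈-allFin; ∈-filter⁺; ∈-filter⁻)
open import Data.List.Relation.Binary.Subset.Propositional using (_⊆_)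
open import Data.List.Relation.Unary.Any using (here; there)
open import Data.Product using (proj₂)
open import Data.Rational using (_⊔_; -_; NonNegative; nonNegative; positive; _≤?_)
import Data.Rational.Properties as ℚ
open import Data.Rational.Solver using (module +-*-Solver)
open import Data.Vec.Functional using (Vector)
open import Function using (_∘_; id)
open import Relation.Nullary using (yes; no; contradiction)
open import Relation.Nullary.Decidable using (toWitness)
open import Relation.Binary.PropositionalEquality

open import Algebra.Properties.Semiring.Sum (CommutativeRing.semiring ℚ.+-*-commutativeRing)
  using (sum; sum-cong-≗; sum-replicate-zero; *-distribˡ-sum)
open +-*-Solver using (solve; _:+_; _:-_; _:*_; _:=_; con)

private
  variable
    m n : ℕ

p≤p+q : ∀ {p q} → 0ℚ ≤ q → p ≤ p + q
p≤p+q {p} {q} 0≤q = begin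
  p       ≡⟨ ℚ.+-identityʳ p ⟨
  p + 0ℚ  ≤⟨ ℚ.+-monoʳ-≤ p 0≤q ⟩
  p + q   ∎
  where open ℚ.≤-Reasoning

p*q≥0 : ∀ {p q} → 0ℚ ≤ p → 0ℚ ≤ q → 0ℚ ≤ p * q
p*q≥0 {p} {q} 0≤p 0≤q =
  ℚ.nonNegative⁻¹ (p * q) {{ℚ.nonNeg*nonNeg⇒nonNeg p {{nonNegative 0≤p}} q {{nonNegative 0≤q}}}}

p≤q⇒0≤q-p : ∀ {p q} → p ≤ q → 0ℚ ≤ q - p
p≤q⇒0≤q-p {p} p≤q = ℚ.≤-trans (ℚ.≤-reflexive (sym (ℚ.+-inverseʳ p))) (ℚ.+-monoˡ-≤ (- p) p≤q)

0<1+p : ∀ {p} → 0ℚ ≤ p → 0ℚ < 1ℚ + p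
0<1+p 0≤p = ℚ.<-≤-trans (ℚ.positive⁻¹ 1ℚ) (p≤p+q 0≤p)

p⊔q≡q+[p-q]⊔0 : ∀ p q → p ⊔ q ≡ q + ((p - q) ⊔ 0ℚ)
p⊔q≡q+[p-q]⊔0 p q = begin
  p ⊔ q                     ≡⟨ cong₂ _⊔_ q+[p-q]≡p (ℚ.+-identityʳ q) ⟨
  (q + (p - q)) ⊔ (q + 0ℚ)  ≡⟨ ℚ.mono-≤-distrib-⊔ (ℚ.+-monoʳ-≤ q) (p - q) 0ℚ ⟨
  q + ((p - q) ⊔ 0ℚ)        ∎
  where
  open ≡-Reasoning
  q+[p-q]≡p : q + (p - q) ≡ p
  q+[p-q]≡p = solve 2 (λ p q → q :+ (p :- q) := p) refl p q

p≤q+[p-q]⊔0 : ∀ p q → p ≤ q + ((p - q) ⊔ 0ℚ)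
p≤q+[p-q]⊔0 p q = ℚ.≤-trans (ℚ.p≤p⊔q p q) (ℚ.≤-reflexive (p⊔q≡q+[p-q]⊔0 p q))

x′⊔y′≤x⊔y+d+e : ∀ {x x′ y y′ d e} → 0ℚ ≤ d → 0ℚ ≤ e →
  x′ ≤ x + d → y′ ≤ y ⊔ (x + e) → x′ ⊔ y′ ≤ (x ⊔ y) + d + e
x′⊔y′≤x⊔y+d+e {x} {y = y} {d = d} {e} 0≤d 0≤e x′≤x+d y′≤y⊔[x+e] =
  ℚ.⊔-lub (ℚ.≤-trans x′≤x+d (ℚ.≤-trans (ℚ.+-monoˡ-≤ d x≤s) (p≤p+q 0≤e)))
          (ℚ.≤-trans y′≤y⊔[x+e] (ℚ.⊔-lub y≤s+d+e x+e≤s+d+e))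
  where
  s = x ⊔ y
  x≤s = ℚ.p≤p⊔q x y
  s≤s+d = p≤p+q {s} 0≤d
  y≤s+d+e = ℚ.≤-trans (ℚ.p≤q⊔p x y) (ℚ.≤-trans s≤s+d (p≤p+q 0≤e))
  x+e≤s+d+e = ℚ.+-monoˡ-≤ e (ℚ.≤-trans x≤s s≤s+d)

½[1-2ε]-bound : ∀ {ε x y} → 0ℚ ≤ ε → 0ℚ ≤ x →
  (1ℚ - ε) * x ≤ (1ℚ + ε) * y + (1ℚ + ε) * y → ½ * (1ℚ - (ε + ε)) * x ≤ y
½[1-2ε]-bound {ε} {x} {y} 0≤ε 0≤x hyp = ℚ.*-cancelˡ-≤-pos r {{positive 0<r}} (begin
  r * (½ * (1ℚ - (ε + ε)) * x)                      ≤⟨ p≤p+q (p*q≥0 (ℚ.+-mono-≤ 0≤ε 0≤ε) (p*q≥0 0≤ε 0≤x)) ⟩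
  r * (½ * (1ℚ - (ε + ε)) * x) + (ε + ε) * (ε * x)  ≡⟨ expand ⟩
  (1ℚ - ε) * x                                      ≤⟨ hyp ⟩
  (1ℚ + ε) * y + (1ℚ + ε) * y                       ≡⟨ ℚ.*-distribʳ-+ y (1ℚ + ε) (1ℚ + ε) ⟨
  r * y                                             ∎)
  where
  open ℚ.≤-Reasoning
  r = (1ℚ + ε) + (1ℚ + ε)
  0<r : 0ℚ < r
  0<r = ℚ.<-≤-trans (0<1+p 0≤ε) (p≤p+q (ℚ.<⇒≤ (0<1+p 0≤ε)))
  expand : r * (½ * (1ℚ - (ε + ε)) * x) + (ε + ε) * (ε * x) ≡ (1ℚ - ε) * x
  expand = solve 2 (λ ε x →
      ((con 1ℚ :+ ε) :+ (con 1ℚ :+ ε)) :* (con ½ :* (con 1ℚ :- (ε :+ ε)) :* x) :+ (ε :+ ε) :* (ε :* x)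
      := (con 1ℚ :- ε) :* x) refl ε x

sumFin≡sum : (f : Vector ℚ m) → sumFin f ≡ sum f
sumFin≡sum f = trans (cong (foldr _+_ 0ℚ) (map-tabulate id f)) (foldr-tabulate f)
  where
  foldr-tabulate : (g : Vector ℚ m) → foldr _+_ 0ℚ (tabulate g) ≡ sum g
  foldr-tabulate {ℕ.zero}  g = refl
  foldr-tabulate {ℕ.suc m} g = cong (_+_ (g zero)) (foldr-tabulate (g ∘ suc))

sum-mono-≤ : {f g : Vector ℚ m} → (∀ u → f u ≤ g u) → sum f ≤ sum g
sum-mono-≤ {ℕ.zero}  _   = ℚ.≤-refl
sum-mono-≤ {ℕ.suc m} f≤g = ℚ.+-mono-≤ (f≤g zero) (sum-mono-≤ (f≤g ∘ suc))

sum-nonneg : {f : Vector ℚ m} → (∀ u → 0ℚ ≤ f u) → 0ℚ ≤ sum f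
sum-nonneg {m} 0≤f = ℚ.≤-trans (ℚ.≤-reflexive (sym (sum-replicate-zero m))) (sum-mono-≤ 0≤f)

δ : Fin m → ℚ → Vector ℚ m
δ x c u with x ≟ u
... | yes _ = c
... | no  _ = 0ℚ

δ-nonneg : ∀ (x : Fin m) {c} u → 0ℚ ≤ c → 0ℚ ≤ δ x c u
δ-nonneg x u 0≤c with x ≟ u
... | yes _ = 0≤c
... | no  _ = ℚ.≤-refl

δ-suc : ∀ (x u : Fin m) c → δ (suc x) c (suc u) ≡ δ x c u
δ-suc x u c with x ≟ u
... | yes _ = refl
... | no  _ = refl

sum-+δ : ∀ (f : Vector ℚ m) x c → sum (λ u → f u + δ x c u) ≡ sum f + c
sum-+δ f zero c = begin
  (f zero + c) + sum (λ u → f (suc u) + 0ℚ)  ≡⟨ cong (_+_ (f zero + c)) (sum-cong-≗ (ℚ.+-identityʳ ∘ f ∘ suc)) ⟩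
  (f zero + c) + sum (f ∘ suc)               ≡⟨ solve 3 (λ x y z → (x :+ y) :+ z := (x :+ z) :+ y) refl (f zero) c _ ⟩
  (f zero + sum (f ∘ suc)) + c               ∎
  where open ≡-Reasoning
sum-+δ f (suc x) c = begin
  (f zero + 0ℚ) + sum (λ u → f (suc u) + δ (suc x) c (suc u))
    ≡⟨ cong₂ _+_ (ℚ.+-identityʳ (f zero)) (sum-cong-≗ (λ u → cong (_+_ (f (suc u))) (δ-suc x u c))) ⟩
  f zero + sum (λ u → f (suc u) + δ x c u)   ≡⟨ cong (_+_ (f zero)) (sum-+δ (f ∘ suc) x c) ⟩
  f zero + (sum (f ∘ suc) + c)               ≡⟨ ℚ.+-assoc (f zero) _ c ⟨
  (f zero + sum (f ∘ suc)) + c               ∎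
  where open ≡-Reasoning

maxMatched-nonneg : ∀ (a : Assignment m n) w u xs → 0ℚ ≤ maxMatched a w u xs
maxMatched-nonneg a w u []       = ℚ.≤-refl
maxMatched-nonneg a w u (j ∷ xs) with a j ≟ u
... | yes _ = ℚ.p≤q⇒p≤r⊔q (w u j) (maxMatched-nonneg a w u xs)
... | no  _ = maxMatched-nonneg a w u xs

maxMatched-∈ : ∀ (a : Assignment m n) w u {j} xs → j ∈ xs → a j ≡ u → w u j ≤ maxMatched a w u xs
maxMatched-∈ a w u (k ∷ xs) j∈ aj≡u with a k ≟ u | j∈
... | yes _   | here refl = ℚ.p≤p⊔q _ _
... | yes _   | there j∈xs = ℚ.p≤q⇒p≤r⊔q (w u k) (maxMatched-∈ a w u xs j∈xs aj≡u)
... | no ak≢u | here refl = contradiction aj≡u ak≢u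
... | no  _   | there j∈xs = maxMatched-∈ a w u xs j∈xs aj≡u

maxMatched-mono-⊆ : ∀ (a : Assignment m n) w u {xs ys} → xs ⊆ ys →
  maxMatched a w u xs ≤ maxMatched a w u ys
maxMatched-mono-⊆ a w u {[]}     {ys} _ = maxMatched-nonneg a w u ys
maxMatched-mono-⊆ a w u {j ∷ xs} {ys} j∷xs⊆ys with a j ≟ u
... | yes aj≡u = ℚ.⊔-lub (maxMatched-∈ a w u ys (j∷xs⊆ys (here refl)) aj≡u)
                         (maxMatched-mono-⊆ a w u (j∷xs⊆ys ∘ there))
... | no  _    = maxMatched-mono-⊆ a w u (j∷xs⊆ys ∘ there)

maxMatched-cong-⊆ : ∀ (a : Assignment m n) w u {xs ys} → xs ⊆ ys → ys ⊆ xs →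
  maxMatched a w u xs ≡ maxMatched a w u ys
maxMatched-cong-⊆ a w u xs⊆ys ys⊆xs =
  ℚ.≤-antisym (maxMatched-mono-⊆ a w u xs⊆ys) (maxMatched-mono-⊆ a w u ys⊆xs)

maxMatched-mono-weights : ∀ (a : Assignment m n) {w w′} → (∀ u j → w u j ≤ w′ u j) →
  ∀ u xs → maxMatched a w u xs ≤ maxMatched a w′ u xs
maxMatched-mono-weights a w≤w′ u []       = ℚ.≤-refl
maxMatched-mono-weights a w≤w′ u (j ∷ xs) with a j ≟ u
... | yes _ = ℚ.⊔-mono-≤ (w≤w′ u j) (maxMatched-mono-weights a w≤w′ u xs)
... | no  _ = maxMatched-mono-weights a w≤w′ u xs

maxMatched-* : ∀ (a : Assignment m n) w c .{{_ : NonNegative c}} u xs →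
  maxMatched a (λ u j → c * w u j) u xs ≡ c * maxMatched a w u xs
maxMatched-* a w c u []       = sym (ℚ.*-zeroʳ c)
maxMatched-* a w c u (j ∷ xs) with a j ≟ u
... | yes _ = trans (cong (_⊔_ (c * w u j)) (maxMatched-* a w c u xs)) (sym (ℚ.*-distribˡ-⊔-nonNeg c _ _))
... | no  _ = maxMatched-* a w c u xs

valueOn : Weights m n → Assignment m n → List (Fin n) → ℚ
valueOn w a xs = sum (λ u → maxMatched a w u xs)

valueOn-nonneg : ∀ (w : Weights m n) a xs → 0ℚ ≤ valueOn w a xs
valueOn-nonneg w a xs = sum-nonneg (λ u → maxMatched-nonneg a w u xs)

value≡valueOn-allFin : ∀ (w : Weights m n) a → value w a ≡ valueOn w a (allFin n)
value≡valueOn-allFin {n = n} w a = sumFin≡sum (λ u → maxMatched a w u (allFin n))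

value-nonneg : ∀ (w : Weights m n) a → 0ℚ ≤ value w a
value-nonneg w a = subst (0ℚ ≤_) (sym (value≡valueOn-allFin w a)) (valueOn-nonneg w a (allFin _))

value-mono-weights : ∀ {w w′ : Weights m n} a → (∀ u j → w u j ≤ w′ u j) → value w a ≤ value w′ a
value-mono-weights {w = w} {w′} a w≤w′ =
  subst₂ _≤_ (sym (value≡valueOn-allFin w a)) (sym (value≡valueOn-allFin w′ a))
    (sum-mono-≤ (λ u → maxMatched-mono-weights a w≤w′ u (allFin _)))

value-* : ∀ (w : Weights m n) a c .{{_ : NonNegative c}} → value (λ u j → c * w u j) a ≡ c * value w a
value-* {n = n} w a c = begin
  value (λ u j → c * w u j) a              ≡⟨ value≡valueOn-allFin _ a ⟩
  valueOn (λ u j → c * w u j) a (allFin n) ≡⟨ sum-cong-≗ (λ u → maxMatched-* a w c u (allFin n)) ⟩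
  sum (λ u → c * maxMatched a w u (allFin n)) ≡⟨ *-distribˡ-sum c (λ u → maxMatched a w u (allFin n)) ⟨
  c * valueOn w a (allFin n)               ≡⟨ cong (c *_) (value≡valueOn-allFin w a) ⟨
  c * value w a                            ∎
  where open ≡-Reasoning

prefix : ∀ k → k ℕ.≤ n → List (Fin n)
prefix ℕ.zero    _   = []
prefix (ℕ.suc k) k<n = fromℕ< k<n ∷ prefix k (ℕ.<⇒≤ k<n)

∈-prefix⁻ : ∀ k (k≤n : k ℕ.≤ n) {i} → i ∈ prefix k k≤n → toℕ i ℕ.< k
∈-prefix⁻ (ℕ.suc k) k<n (here refl) = subst (ℕ._< ℕ.suc k) (sym (toℕ-fromℕ< k<n)) (ℕ.n<1+n k)
∈-prefix⁻ (ℕ.suc k) k<n (there i∈) = ℕ.m<n⇒m<1+n (∈-prefix⁻ k _ i∈)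

∈-prefix⁺ : ∀ k (k≤n : k ℕ.≤ n) {i} → toℕ i ℕ.< k → i ∈ prefix k k≤n
∈-prefix⁺ (ℕ.suc k) k<n {i} i<1+k with toℕ i ℕ.≟ k
... | yes i≡k = here (toℕ-injective (trans i≡k (sym (toℕ-fromℕ< k<n))))
... | no  i≢k = there (∈-prefix⁺ k _ (ℕ.≤∧≢⇒< (ℕ.s≤s⁻¹ i<1+k) i≢k))

before-fromℕ<⊆prefix : ∀ {k} (k<n : k ℕ.< n) → before (fromℕ< k<n) ⊆ prefix k (ℕ.<⇒≤ k<n)
before-fromℕ<⊆prefix {n} {k} k<n {i} i∈ = ∈-prefix⁺ k _
  (subst (toℕ i ℕ.<_) (toℕ-fromℕ< k<n) (proj₂ (∈-filter⁻ (_<? fromℕ< k<n) {xs = allFin n} i∈)))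

prefix⊆before-fromℕ< : ∀ {k} (k<n : k ℕ.< n) → prefix k (ℕ.<⇒≤ k<n) ⊆ before (fromℕ< k<n)
prefix⊆before-fromℕ< {k = k} k<n {i} i∈ = ∈-filter⁺ (_<? fromℕ< k<n) (∈-allFin i)
  (subst (toℕ i ℕ.<_) (sym (toℕ-fromℕ< k<n)) (∈-prefix⁻ k _ i∈))

value≡valueOn-prefix : ∀ (w : Weights m n) a → value w a ≡ valueOn w a (prefix n ℕ.≤-refl)
value≡valueOn-prefix {n = n} w a = trans (value≡valueOn-allFin w a) (sum-cong-≗ λ u →
  maxMatched-cong-⊆ a w u (λ {i} _ → ∈-prefix⁺ n _ (toℕ<n i)) (λ {i} _ → ∈-allFin i))

incrementAfter : Weights m n → Assignment m n → List (Fin n) → Fin n → Fin m → ℚ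
incrementAfter w a xs j u = (w u j - maxMatched a w u xs) ⊔ 0ℚ

jointValueOn : Weights m n → Assignment m n → Assignment m n → List (Fin n) → ℚ
jointValueOn w a b xs = sum (λ u → maxMatched a w u xs ⊔ maxMatched b w u xs)

maxMatched-∷-own : ∀ (w : Weights m n) a u j xs →
  maxMatched a w u (j ∷ xs) ≡ maxMatched a w u xs + δ (a j) (incrementAfter w a xs j (a j)) u
maxMatched-∷-own w a u j xs with a j ≟ u
... | yes refl = p⊔q≡q+[p-q]⊔0 (w (a j) j) (maxMatched a w (a j) xs)
... | no  _    = sym (ℚ.+-identityʳ _)

maxMatched-∷-other : ∀ (w : Weights m n) a b u j xs {c} → incrementAfter w a xs j (b j) ≤ c →
  maxMatched b w u (j ∷ xs) ≤ maxMatched b w u xs ⊔ (maxMatched a w u xs + δ (b j) c u)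
maxMatched-∷-other w a b u j xs {c} increment≤c with b j ≟ u
... | yes refl = ℚ.⊔-lub (ℚ.≤-trans (p≤q+[p-q]⊔0 (w u j) A)
                                    (ℚ.≤-trans (ℚ.+-monoʳ-≤ A increment≤c) (ℚ.p≤q⊔p B (A + c))))
                         (ℚ.p≤p⊔q B (A + c))
  where
  A = maxMatched a w u xs
  B = maxMatched b w u xs
... | no  _    = ℚ.p≤p⊔q (maxMatched b w u xs) (maxMatched a w u xs + 0ℚ)

valueOn-∷ : ∀ (w : Weights m n) a j xs →
  valueOn w a (j ∷ xs) ≡ valueOn w a xs + incrementAfter w a xs j (a j)
valueOn-∷ w a j xs = trans (sum-cong-≗ (λ u → maxMatched-∷-own w a u j xs)) (sum-+δ _ (a j) _)

-- Coordinate a j of the potential grows by a's gain D; coordinate b j grows by at most the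
-- increment b j would have offered to a, which greedy bounds by D.
jointValueOn-∷ : ∀ (w : Weights m n) a b j xs →
  incrementAfter w a xs j (b j) ≤ incrementAfter w a xs j (a j) →
  jointValueOn w a b (j ∷ xs) ≤
    jointValueOn w a b xs + incrementAfter w a xs j (a j) + incrementAfter w a xs j (a j)
jointValueOn-∷ w a b j xs greedy = begin
  jointValueOn w a b (j ∷ xs)                        ≤⟨ sum-mono-≤ pointwise ⟩
  sum (λ u → (A u ⊔ B u) + δ (a j) D u + δ (b j) D u) ≡⟨ sum-+δ _ (b j) D ⟩
  sum (λ u → (A u ⊔ B u) + δ (a j) D u) + D          ≡⟨ cong (_+ D) (sum-+δ _ (a j) D) ⟩
  jointValueOn w a b xs + D + D                       ∎
  where
  open ℚ.≤-Reasoning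
  A B : Vector ℚ _
  A u = maxMatched a w u xs
  B u = maxMatched b w u xs
  D = incrementAfter w a xs j (a j)
  0≤D : 0ℚ ≤ D
  0≤D = ℚ.p≤q⊔p (w (a j) j - A (a j)) 0ℚ
  pointwise : ∀ u → maxMatched a w u (j ∷ xs) ⊔ maxMatched b w u (j ∷ xs) ≤
                    (A u ⊔ B u) + δ (a j) D u + δ (b j) D u
  pointwise u = x′⊔y′≤x⊔y+d+e {A u} {y = B u} (δ-nonneg (a j) u 0≤D) (δ-nonneg (b j) u 0≤D)
    (ℚ.≤-reflexive (maxMatched-∷-own w a u j xs)) (maxMatched-∷-other w a b u j xs greedy)

module _ (w : Weights m n) (a : Assignment m n) (greedy : IsGreedyRun w a) (b : Assignment m n) where

  jointValueOn≤valueOn+valueOn : ∀ k (k≤n : k ℕ.≤ n) →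
    jointValueOn w a b (prefix k k≤n) ≤ valueOn w a (prefix k k≤n) + valueOn w a (prefix k k≤n)
  jointValueOn≤valueOn+valueOn ℕ.zero    _   = p≤p+q (valueOn-nonneg w a [])
  jointValueOn≤valueOn+valueOn (ℕ.suc k) k<n = begin
    jointValueOn w a b (j ∷ xs)    ≤⟨ jointValueOn-∷ w a b j xs greedy-at-j ⟩
    jointValueOn w a b xs + D + D  ≤⟨ ℚ.+-monoˡ-≤ D (ℚ.+-monoˡ-≤ D (jointValueOn≤valueOn+valueOn k _)) ⟩
    (S + S) + D + D                ≡⟨ solve 2 (λ S D → (S :+ S) :+ D :+ D := (S :+ D) :+ (S :+ D)) refl S D ⟩
    (S + D) + (S + D)              ≡⟨ cong₂ _+_ (valueOn-∷ w a j xs) (valueOn-∷ w a j xs) ⟨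
    valueOn w a (j ∷ xs) + valueOn w a (j ∷ xs) ∎
    where
    open ℚ.≤-Reasoning
    j = fromℕ< k<n
    xs = prefix k (ℕ.<⇒≤ k<n)
    D = incrementAfter w a xs j (a j)
    S = valueOn w a xs
    increment≡ : ∀ u → increment w a j u ≡ incrementAfter w a xs j u
    increment≡ u = cong (λ v → (w u j - v) ⊔ 0ℚ)
      (maxMatched-cong-⊆ a w u (before-fromℕ<⊆prefix k<n) (prefix⊆before-fromℕ< k<n))
    greedy-at-j : incrementAfter w a xs j (b j) ≤ D
    greedy-at-j = subst₂ _≤_ (increment≡ (b j)) (increment≡ (a j)) (greedy j (b j))

  greedy-½-competitive : value w b ≤ value w a + value w a
  greedy-½-competitive = begin
    value w b                          ≡⟨ value≡valueOn-prefix w b ⟩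
    valueOn w b P                      ≤⟨ sum-mono-≤ (λ u → ℚ.p≤q⊔p (maxMatched a w u P) (maxMatched b w u P)) ⟩
    jointValueOn w a b P               ≤⟨ jointValueOn≤valueOn+valueOn n ℕ.≤-refl ⟩
    valueOn w a P + valueOn w a P      ≡⟨ cong₂ _+_ (value≡valueOn-prefix w a) (value≡valueOn-prefix w a) ⟨
    value w a + value w a              ∎
    where
    open ℚ.≤-Reasoning
    P = prefix n ℕ.≤-refl

lemma3p4 : (ε : ℚ) → 0ℚ < ε → ε < + 1 / 10 →
    (m n : ℕ) (w w̃ : Weights m n) → Nonneg w →
    (∀ u j → (1ℚ - ε) * w u j ≤ w̃ u j) →
    (∀ u j → w̃ u j ≤ (1ℚ + ε) * w u j) →
    (a : Assignment m n) → IsGreedyRun w̃ a →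
    (b : Assignment m n) →
    ½ * (1ℚ - (ε + ε)) * value w b ≤ value w a
lemma3p4 ε 0<ε ε<1/10 m n w w̃ _ w̃-lower w̃-upper a greedy b =
  ½[1-2ε]-bound 0≤ε (value-nonneg w b) (begin
    (1ℚ - ε) * value w b                         ≡⟨ value-* w b (1ℚ - ε) {{nonNegative 0≤1-ε}} ⟨
    value (λ u j → (1ℚ - ε) * w u j) b           ≤⟨ value-mono-weights b w̃-lower ⟩
    value w̃ b                                    ≤⟨ greedy-½-competitive w̃ a greedy b ⟩
    value w̃ a + value w̃ a                        ≤⟨ ℚ.+-mono-≤ w̃a≤ w̃a≤ ⟩
    (1ℚ + ε) * value w a + (1ℚ + ε) * value w a  ∎)
  where
  open ℚ.≤-Reasoning
  0≤ε = ℚ.<⇒≤ 0<ε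
  0≤1-ε : 0ℚ ≤ 1ℚ - ε
  0≤1-ε = p≤q⇒0≤q-p (ℚ.<⇒≤ (ℚ.<-≤-trans ε<1/10 (toWitness {a? = + 1 / 10 ≤? 1ℚ} _)))
  w̃a≤ : value w̃ a ≤ (1ℚ + ε) * value w a
  w̃a≤ = ℚ.≤-trans (value-mono-weights a w̃-upper)
          (ℚ.≤-reflexive (value-* w a (1ℚ + ε) {{nonNegative (ℚ.<⇒≤ (0<1+p 0≤ε))}}))
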